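{- Let $p_1,\dots,p_m$ be a proper pin sequence in the plot of a permutation. Then for every $i$ with $3\le i\le m$, the point $p_i$ does not separate any two members of $\{p_1,\dots,p_{i-2}\}$; that is, neither the vertical line nor the horizontal line through $p_i$ strictly separates two points of $\{p_1,\dots,p_{i-2}\}$.
   Context: The plot of a permutation $\pi$ of $[n]$ is the point set $\{(i,\pi(i)):i\in[n]\}$. For points $q_1,\dots,q_m$, $\operatorname{rect}(q_1,\dots,q_m)$ is the smallest closed axes-parallel rectangle containing them. A pin sequence is a sequence of distinct points $p_1,\dots,p_m$ of the plot such that for each $i\ge3$, writing $\operatorname{rect}(p_1,\dots,p_{i-1})=[a,b]\times[c,d]$ and $p_i=(x,y)$: $p_i\notin\operatorname{rect}(p_1,\dots,p_{i-1})$ and either $a<x<b$ or $c<y<d$. Such $p_i$ is a left pin if $x<a$, right pin if $x>b$, up pin if $y>d$, down pin if $y<c$. The pin sequence is proper if (maximality) each $p_i$, $i\ge3$, is extreme in its direction among all points of the plot that could serve as a pin of that direction for $\operatorname{rect}(p_1,\dots,p_{i-1})$ (e.g. for a right pin $p_i=(x,y)$ there is no point of the plot in $(x,n]\times[c,d]$), and (separation) for each $i\ge2$ with $i+1\le m$, $p_{i+1}$ lies horizontally or vertically strictly between $\operatorname{rect}(p_1,\dots,p_{i-1})$ and $p_i$ (the vertical or horizontal line through $p_{i+1}$ strictly separates them). -}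

module Defs where

open import Data.Nat using (ℕ; zero; suc; _≤_; _<_; _⊓_; _⊔_)
open import Data.Fin using (Fin; toℕ)
open import Data.Fin.Permutation using (Permutation′; _⟨$⟩ʳ_)
open import Data.Product using (Σ; _×_; proj₁; proj₂)
open import Data.Sum using (_⊎_)
open import Relation.Nullary using (¬_)
open import Relation.Binary.PropositionalEquality using (_≡_)

Point : Set
Point = ℕ × ℕ

X : Point → ℕ
X = proj₁

Y : Point → ℕ
Y = proj₂

-- The plot of a permutation π of [n] = {1,…,n}: the points (i , π(i)),
-- with 1-based coordinates (Fin n is 0-based, hence the suc).
InPlot : ∀ {n} → Permutation′ n → Point → Set
InPlot {n} π q = Σ (Fin n) λ c → X q ≡ suc (toℕ c) × Y q ≡ suc (toℕ (π ⟨$⟩ʳ c))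

-- A sequence of points is given as  p : ℕ → Point  (0-based index;
-- only indices < m matter for a sequence of length m).
-- Minimum / maximum of f 0, …, f k.
minUpTo : (ℕ → ℕ) → ℕ → ℕ
minUpTo f zero = f zero
minUpTo f (suc k) = minUpTo f k ⊓ f (suc k)

maxUpTo : (ℕ → ℕ) → ℕ → ℕ
maxUpTo f zero = f zero
maxUpTo f (suc k) = maxUpTo f k ⊔ f (suc k)

rectA rectB rectC rectD : (ℕ → Point) → ℕ → ℕ
rectA p k = minUpTo (λ j → X (p j)) k
rectB p k = maxUpTo (λ j → X (p j)) k
rectC p k = minUpTo (λ j → Y (p j)) k
rectD p k = maxUpTo (λ j → Y (p j)) k

InRect : (ℕ → Point) → ℕ → Point → Set
InRect p k q = (rectA p k ≤ X q × X q ≤ rectB p k)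
             × (rectC p k ≤ Y q × Y q ≤ rectD p k)

IsPin : (ℕ → Point) → ℕ → Point → Set
IsPin p k q = ¬ InRect p k q
  × ((rectA p k < X q × X q < rectB p k) ⊎ (rectC p k < Y q × Y q < rectD p k))

LeftPin RightPin UpPin DownPin : (ℕ → Point) → ℕ → Point → Set
LeftPin  p k q = IsPin p k q × X q < rectA p k
RightPin p k q = IsPin p k q × rectB p k < X q
UpPin    p k q = IsPin p k q × rectD p k < Y q
DownPin  p k q = IsPin p k q × Y q < rectC p k

-- p 0, …, p (m-1) is a pin sequence in the plot of π.
-- (The paper's p_i is our p (i - 1); the paper's condition for i ≥ 3
--  is for our index k + 2, with rect(p_1,…,p_{i-1}) = rect(p 0,…,p (k+1)).)
PinSequence : ∀ {n} → Permutation′ n → ℕ → (ℕ → Point) → Set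
PinSequence π m p =
    (∀ i → i < m → InPlot π (p i))
  × (∀ i j → i < m → j < m → p i ≡ p j → i ≡ j)
  × (∀ k → suc (suc k) < m → IsPin p (suc k) (p (suc (suc k))))

Maximal : ∀ {n} → Permutation′ n → ℕ → (ℕ → Point) → Set
Maximal π m p = ∀ k → suc (suc k) < m →
  let q = p (suc (suc k)) in
    (LeftPin p (suc k) q → ∀ r → InPlot π r → LeftPin p (suc k) r → X q ≤ X r)
  × (RightPin p (suc k) q → ∀ r → InPlot π r → RightPin p (suc k) r → X r ≤ X q)
  × (UpPin p (suc k) q → ∀ r → InPlot π r → UpPin p (suc k) r → Y r ≤ Y q)
  × (DownPin p (suc k) q → ∀ r → InPlot π r → DownPin p (suc k) r → Y q ≤ Y r)

-- Separation: for paper indices i ≥ 2 with i + 1 ≤ m (our index k + 1, k ≥ 0),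
-- p_{i+1} lies strictly between rect(p_1,…,p_{i-1}) and p_i,
-- horizontally or vertically.
Separation : ℕ → (ℕ → Point) → Set
Separation m p = ∀ k → suc (suc k) < m →
  let q = p (suc k) ; r = p (suc (suc k)) in
      (rectB p k < X r × X r < X q)
    ⊎ (X q < X r × X r < rectA p k)
    ⊎ (rectD p k < Y r × Y r < Y q)
    ⊎ (Y q < Y r × Y r < rectC p k)

ProperPinSequence : ∀ {n} → Permutation′ n → ℕ → (ℕ → Point) → Set
ProperPinSequence π m p = PinSequence π m p × Maximal π m p × Separation m p

SepX SepY : Point → Point → Point → Set
SepX q u v = X u < X q × X q < X v
SepY q u v = Y u < Y q × Y q < Y v

{-# OPTIONS --safe #-}
module Submission where

-- Separation puts p_i strictly beyond rect(p_1,…,p_{i-2}) in one coordinate and,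
-- in that coordinate, strictly inside the span of rect(p_1,…,p_{i-1}).  As p_i is a
-- pin it lies outside rect(p_1,…,p_{i-1}), so in the other coordinate it leaves that
-- span, and hence also the smaller one of rect(p_1,…,p_{i-2}).  Being beyond
-- rect(p_1,…,p_{i-2}) in both coordinates, p_i separates no two of its points.

open import Defs
open import Data.Empty using (⊥-elim)
open import Data.Nat using (ℕ; suc; zero; _<_; _≤_; _≤?_; z≤n; s≤s)
open import Data.Nat.Properties
open import Data.Fin.Permutation using (Permutation′)
open import Data.Product using (_×_; _,_; proj₁)
open import Data.Sum using (_⊎_; inj₁; inj₂)
open import Relation.Binary.PropositionalEquality using (refl)
open import Relation.Nullary using (¬_; yes; no)

module _ (f : ℕ → ℕ) where

  minUpTo-≤ : ∀ {j} k → j ≤ k → minUpTo f k ≤ f j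
  minUpTo-≤ zero    z≤n = ≤-refl
  minUpTo-≤ (suc k) j≤k with m≤n⇒m<n∨m≡n j≤k
  ... | inj₁ (s≤s j≤k′) = ≤-trans (m⊓n≤m _ _) (minUpTo-≤ k j≤k′)
  ... | inj₂ refl       = m⊓n≤n _ _

  ≤-maxUpTo : ∀ {j} k → j ≤ k → f j ≤ maxUpTo f k
  ≤-maxUpTo zero    z≤n = ≤-refl
  ≤-maxUpTo (suc k) j≤k with m≤n⇒m<n∨m≡n j≤k
  ... | inj₁ (s≤s j≤k′) = ≤-trans (≤-maxUpTo k j≤k′) (m≤m⊔n _ _)
  ... | inj₂ refl       = m≤n⊔m _ _

  minUpTo≤maxUpTo : ∀ k → minUpTo f k ≤ maxUpTo f k
  minUpTo≤maxUpTo k = ≤-trans (minUpTo-≤ k z≤n) (≤-maxUpTo k z≤n)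

  InRange : ℕ → ℕ → Set
  InRange k v = minUpTo f k ≤ v × v ≤ maxUpTo f k

  OutsideRange : ℕ → ℕ → Set
  OutsideRange k v = maxUpTo f k < v ⊎ v < minUpTo f k

  BetweenRangeAndNext : ℕ → ℕ → Set
  BetweenRangeAndNext k v =
    (maxUpTo f k < v × v < f (suc k)) ⊎ (f (suc k) < v × v < minUpTo f k)

  ¬inRange⇒outsideRange : ∀ {k v} → ¬ InRange k v → OutsideRange k v
  ¬inRange⇒outsideRange {k} {v} v∉ with minUpTo f k ≤? v | v ≤? maxUpTo f k
  ... | yes lo≤v | yes v≤hi = ⊥-elim (v∉ (lo≤v , v≤hi))
  ... | yes _    | no  v≰hi = inj₁ (≰⇒> v≰hi)
  ... | no  lo≰v | _        = inj₂ (≰⇒> lo≰v)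

  outsideRange-suc⇒outsideRange : ∀ {k v} → OutsideRange (suc k) v → OutsideRange k v
  outsideRange-suc⇒outsideRange (inj₁ hi<v) = inj₁ (≤-<-trans (m≤m⊔n _ _) hi<v)
  outsideRange-suc⇒outsideRange (inj₂ v<lo) = inj₂ (<-≤-trans v<lo (m⊓n≤m _ _))

  betweenRangeAndNext⇒outsideRange : ∀ {k v} → BetweenRangeAndNext k v → OutsideRange k v
  betweenRangeAndNext⇒outsideRange (inj₁ (hi<v , _)) = inj₁ hi<v
  betweenRangeAndNext⇒outsideRange (inj₂ (_ , v<lo)) = inj₂ v<lo

  betweenRangeAndNext⇒inRange-suc : ∀ {k v} → BetweenRangeAndNext k v → InRange (suc k) v
  betweenRangeAndNext⇒inRange-suc {k} (inj₁ (hi<v , v<next)) =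
    ≤-trans (m⊓n≤m _ _) (≤-trans (minUpTo≤maxUpTo k) (<⇒≤ hi<v)) ,
    ≤-trans (<⇒≤ v<next) (m≤n⊔m _ _)
  betweenRangeAndNext⇒inRange-suc {k} (inj₂ (next<v , v<lo)) =
    ≤-trans (m⊓n≤n _ _) (<⇒≤ next<v) ,
    ≤-trans (<⇒≤ v<lo) (≤-trans (minUpTo≤maxUpTo k) (m≤m⊔n _ _))

  outsideRange⇒¬between : ∀ {k v j l} → OutsideRange k v → j ≤ k → l ≤ k →
                          ¬ (f j < v × v < f l)
  outsideRange⇒¬between {k} (inj₁ hi<v) _ l≤k (_ , v<fl) =
    <-asym hi<v (<-≤-trans v<fl (≤-maxUpTo k l≤k))
  outsideRange⇒¬between {k} (inj₂ v<lo) j≤k _ (fj<v , _) =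
    <-asym v<lo (≤-<-trans (minUpTo-≤ k j≤k) fj<v)

module _ (p : ℕ → Point) where

  xs ys : ℕ → ℕ
  xs j = X (p j)
  ys j = Y (p j)

  separation⇒betweenRangeAndNext : ∀ {m} → Separation m p → ∀ k → suc (suc k) < m →
    BetweenRangeAndNext xs k (X (p (suc (suc k)))) ⊎
    BetweenRangeAndNext ys k (Y (p (suc (suc k))))
  separation⇒betweenRangeAndNext sep k k+2<m with sep k k+2<m
  ... | inj₁ right              = inj₁ (inj₁ right)
  ... | inj₂ (inj₁ left)        = inj₁ (inj₂ left)
  ... | inj₂ (inj₂ (inj₁ up))   = inj₂ (inj₁ up)
  ... | inj₂ (inj₂ (inj₂ down)) = inj₂ (inj₂ down)

  outsideRect⇒outsideRanges : ∀ {k} q → ¬ InRect p (suc k) q →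
    BetweenRangeAndNext xs k (X q) ⊎ BetweenRangeAndNext ys k (Y q) →
    OutsideRange xs k (X q) × OutsideRange ys k (Y q)
  outsideRect⇒outsideRanges {k} q q∉ (inj₁ betweenX) =
    betweenRangeAndNext⇒outsideRange xs betweenX ,
    outsideRange-suc⇒outsideRange ys {k} (¬inRange⇒outsideRange ys {suc k} λ inY →
      q∉ (betweenRangeAndNext⇒inRange-suc xs betweenX , inY))
  outsideRect⇒outsideRanges {k} q q∉ (inj₂ betweenY) =
    outsideRange-suc⇒outsideRange xs {k} (¬inRange⇒outsideRange xs {suc k} λ inX →
      q∉ (inX , betweenRangeAndNext⇒inRange-suc ys betweenY)) ,
    betweenRangeAndNext⇒outsideRange ys betweenY

  outsideRanges⇒¬separates : ∀ {k q j l} →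
    OutsideRange xs k (X q) × OutsideRange ys k (Y q) → j ≤ k → l ≤ k →
    ¬ SepX q (p j) (p l) × ¬ SepY q (p j) (p l)
  outsideRanges⇒¬separates (outX , outY) j≤k l≤k =
    outsideRange⇒¬between xs outX j≤k l≤k , outsideRange⇒¬between ys outY j≤k l≤k

lemma3p2 : ∀ {n} (π : Permutation′ n) (m : ℕ) (p : ℕ → Point) →
    ProperPinSequence π m p →
    ∀ i → i < m → ∀ j k → suc j < i → suc k < i →
      ¬ SepX (p i) (p j) (p k) × ¬ SepY (p i) (p j) (p k)
lemma3p2 π m p ((_ , _ , pin) , _ , sep) (suc (suc i)) i+2<m j k
         (s≤s (s≤s j≤i)) (s≤s (s≤s k≤i)) =
  outsideRanges⇒¬separates p
    (outsideRect⇒outsideRanges p (p (suc (suc i))) (proj₁ (pin i i+2<m))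
      (separation⇒betweenRangeAndNext p sep i i+2<m))
    j≤i k≤i
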